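{- Let $p\in\{0,1\}^m$. If there exists $N_0\in\mathbb{N}$ such that $g_p(n,m+1)\not\equiv 0 \pmod{x+1}$ (in $\mathbb{Z}[x]$) for all $n>N_0$, then $D_p(n)=n$ for all $n>N_0$; in particular $p$ is evasive.
   Context: Alphabet $\{0,1\}$; $wt(s)$ is the number of 1's in $s$. For $n\ge0$, $g_p(n,m+1)=\sum_{s}x^{wt(s)}\in\mathbb{Z}[x]$, the sum over all $s\in\{0,1\}^n$ containing $p$ as a contiguous substring. $D_p(n)$ is the deterministic decision tree complexity of deciding whether $p$ occurs as a contiguous substring of an unknown $s\in\{0,1\}^n$ (minimum over correct deterministic adaptive query algorithms of the worst-case number of bits queried). $p$ is evasive if there exists $N_0$ with $D_p(n)=n$ for all $n>N_0$. -}

module Defs where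

open import Data.Bool using (Bool; true; false; if_then_else_)
open import Data.Bool.Properties using () renaming (_≟_ to _≟ᴮ_)
open import Data.Nat using (ℕ; zero; suc; _+_; _<_; _≥_; _≤_; _⊔_; _≡ᵇ_)
open import Data.Integer using (ℤ; +_; 0ℤ; 1ℤ) renaming (_+_ to _+ℤ_; _*_ to _*ℤ_)
open import Data.Fin using (Fin)
open import Data.Vec using (Vec; []; _∷_; lookup; toList)
open import Data.List using (List; []; _∷_; _++_; map; foldr)
open import Data.List.Relation.Binary.Infix.Heterogeneous using (Infix)
open import Data.List.Relation.Binary.Infix.Heterogeneous.Properties using (infix?)
open import Data.Product using (Σ; ∃; _×_; _,_)
open import Relation.Binary.PropositionalEquality using (_≡_)
open import Relation.Nullary using (¬_; Dec)
open import Relation.Nullary.Decidable using (⌊_⌋)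

-- Binary strings: a string of length n is a Vec Bool n (false = 0, true = 1).

Occurs : ∀ {m n} → Vec Bool m → Vec Bool n → Set
Occurs p s = Infix _≡_ (toList p) (toList s)

occurs? : ∀ {m n} (p : Vec Bool m) (s : Vec Bool n) → Dec (Occurs p s)
occurs? p s = infix? _≟ᴮ_ (toList p) (toList s)

wt : ∀ {n} → Vec Bool n → ℕ
wt []           = 0
wt (false ∷ s)  = wt s
wt (true  ∷ s)  = suc (wt s)

allStrings : (n : ℕ) → List (Vec Bool n)
allStrings zero    = [] ∷ []
allStrings (suc n) = map (false ∷_) (allStrings n) ++ map (true ∷_) (allStrings n)

-- Polynomials in ℤ[x], represented by their coefficient sequence
-- (coefficient of x^k at index k), with finite support.

Poly : Set
Poly = ℕ → ℤ

FinSupp : Poly → Set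
FinSupp f = ∃ λ B → ∀ k → B ≤ k → f k ≡ 0ℤ

-- Coefficients of (x+1) * q : c_0 = q_0, c_{k+1} = q_{k+1} + q_k.
mulXplus1 : Poly → Poly
mulXplus1 q zero    = q zero
mulXplus1 q (suc k) = q (suc k) +ℤ q k

XPlus1Divides : Poly → Set
XPlus1Divides f = ∃ λ q → FinSupp q × (∀ k → f k ≡ mulXplus1 q k)

-- g_p(n, m+1) = Σ_{s ∈ {0,1}^n, p occurs in s} x^{wt s}; its k-th coefficient
-- is the number of such s with wt s = k.
g : ∀ {m} → Vec Bool m → ℕ → Poly
g p n k = foldr (λ s acc → (if ⌊ occurs? p s ⌋ then (if wt s ≡ᵇ k then 1ℤ else 0ℤ) else 0ℤ) +ℤ acc)
                0ℤ (allStrings n)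

data DTree (n : ℕ) : Set where
  leaf  : Bool → DTree n
  query : Fin n → (ifZero ifOne : DTree n) → DTree n

eval : ∀ {n} → DTree n → Vec Bool n → Bool
eval (leaf b)        s = b
eval (query i t₀ t₁) s = if lookup s i then eval t₁ s else eval t₀ s

depth : ∀ {n} → DTree n → ℕ
depth (leaf _)        = 0
depth (query _ t₀ t₁) = suc (depth t₀ ⊔ depth t₁)

Decides : ∀ {m n} → Vec Bool m → DTree n → Set
Decides p t = ∀ s → eval t s ≡ ⌊ occurs? p s ⌋

DIs : ∀ {m} → Vec Bool m → ℕ → ℕ → Set
DIs {m} p n d = (∃ λ (t : DTree n) → Decides p t × depth t ≡ d)
              × (∀ (t : DTree n) → Decides p t → d ≤ depth t)

Evasive : ∀ {m} → Vec Bool m → Set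
Evasive p = ∃ λ N₀ → ∀ n → N₀ < n → DIs p n n

-- A function computed by a decision tree of depth d < n has a weight enumerator
-- Σ_{h(s)=1} x^{wt s} divisible by x + 1 (Rivest–Vuillemin).  At a leaf the
-- function is constant on a cube of positive dimension, so its enumerator is
-- c (1 + x)^n.  At a query of x_i the enumerator splits as A + x B, where A and B
-- are the enumerators of the two restrictions x_i = 0, 1; these are computed by
-- the subtrees with x_i fixed, of depth < n - 1.  Since g_p(n) is the enumerator
-- of the occurrence indicator, non-divisibility rules out every tree of depth
-- below n, and the tree querying all n bits attains n.
module Submission where

open import Defs
open import Data.Bool using (Bool; true; false; if_then_else_)
open import Data.Nat using (ℕ; zero; suc; _<_; _≤_; _⊔_; _≡ᵇ_; s≤s; _<?_)
open import Data.Nat.Properties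
  using (≤-refl; ≤-trans; n≤1+n; ≤-<-trans; ≮⇒≥; m≤m⊔n; m≤n⊔m; ⊔-mono-≤; ⊔-idem)
open import Data.Integer using (ℤ; 0ℤ; 1ℤ) renaming (_+_ to _+ℤ_)
open import Data.Integer.Properties using (+-identityˡ; +-identityʳ; +-assoc; +-commutativeSemigroup)
open import Algebra.Properties.CommutativeSemigroup +-commutativeSemigroup using (interchange)
open import Data.Fin using (Fin; zero; suc; punchOut; _≟_)
open import Data.Fin.Properties using (punchIn-punchOut)
open import Data.Vec using (Vec; []; _∷_; lookup; insertAt)
open import Data.Vec.Properties using (insertAt-lookup; insertAt-punchIn)
open import Data.List using (List; []; _∷_; _++_; map; foldr)
open import Data.List.Properties using (foldr-map)
open import Data.Product using (_×_; _,_)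
open import Relation.Nullary using (¬_; yes; no; contradiction)
open import Relation.Nullary.Decidable using (⌊_⌋)
open import Relation.Binary.PropositionalEquality
  using (_≡_; _≗_; refl; sym; trans; cong; cong₂; subst; module ≡-Reasoning)

infixl 6 _+ₚ_

_+ₚ_ : Poly → Poly → Poly
(f +ₚ f') k = f k +ℤ f' k

mulX : Poly → Poly
mulX f zero    = 0ℤ
mulX f (suc k) = f k

+ₚ-cong : ∀ {f f' h h'} → f ≗ f' → h ≗ h' → f +ₚ h ≗ f' +ₚ h'
+ₚ-cong f≗f' h≗h' k = cong₂ _+ℤ_ (f≗f' k) (h≗h' k)

mulX-cong : ∀ {f f'} → f ≗ f' → mulX f ≗ mulX f'
mulX-cong f≗f' zero    = refl
mulX-cong f≗f' (suc k) = f≗f' k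

mulX-distrib-+ₚ : ∀ f f' → mulX (f +ₚ f') ≗ mulX f +ₚ mulX f'
mulX-distrib-+ₚ f f' zero    = refl
mulX-distrib-+ₚ f f' (suc k) = refl

+ₚ-mulX-interchange : ∀ a b c d →
  (a +ₚ mulX b) +ₚ mulX (c +ₚ mulX d) ≗ (a +ₚ mulX c) +ₚ mulX (b +ₚ mulX d)
+ₚ-mulX-interchange a b c d k = begin
  (a k +ℤ mulX b k) +ℤ mulX (c +ₚ mulX d) k    ≡⟨ cong (a k +ℤ mulX b k +ℤ_) (mulX-distrib-+ₚ c (mulX d) k) ⟩
  (a k +ℤ mulX b k) +ℤ (mulX c k +ℤ mulX (mulX d) k)
    ≡⟨ interchange (a k) (mulX b k) (mulX c k) (mulX (mulX d) k) ⟩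
  (a k +ℤ mulX c k) +ℤ (mulX b k +ℤ mulX (mulX d) k)
    ≡⟨ cong (a k +ℤ mulX c k +ℤ_) (sym (mulX-distrib-+ₚ b (mulX d) k)) ⟩
  (a k +ℤ mulX c k) +ℤ mulX (b +ₚ mulX d) k    ∎
  where open ≡-Reasoning

finSupp-resp-≗ : ∀ {f f'} → f ≗ f' → FinSupp f → FinSupp f'
finSupp-resp-≗ f≗f' (B , vanish) = B , λ k B≤k → trans (sym (f≗f' k)) (vanish k B≤k)

finSupp-+ₚ : ∀ {f f'} → FinSupp f → FinSupp f' → FinSupp (f +ₚ f')
finSupp-+ₚ (B , vanish) (B' , vanish') = B ⊔ B' , λ k B⊔B'≤k →
  cong₂ _+ℤ_ (vanish k (≤-trans (m≤m⊔n B B') B⊔B'≤k))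
             (vanish' k (≤-trans (m≤n⊔m B B') B⊔B'≤k))

finSupp-mulX : ∀ {f} → FinSupp f → FinSupp (mulX f)
finSupp-mulX (B , vanish) = suc B , λ { zero () ; (suc k) (s≤s B≤k) → vanish k B≤k }

divides-resp-≗ : ∀ {f f'} → f ≗ f' → XPlus1Divides f → XPlus1Divides f'
divides-resp-≗ f≗f' (q , q-fin , f≗) = q , q-fin , λ k → trans (sym (f≗f' k)) (f≗ k)

divides-+ₚ : ∀ {f f'} → XPlus1Divides f → XPlus1Divides f' → XPlus1Divides (f +ₚ f')
divides-+ₚ (q , q-fin , f≗) (q' , q'-fin , f'≗) =
  q +ₚ q' , finSupp-+ₚ q-fin q'-fin , product
  where
  product : ∀ k → _
  product zero    = cong₂ _+ℤ_ (f≗ zero) (f'≗ zero)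
  product (suc k) = trans (cong₂ _+ℤ_ (f≗ (suc k)) (f'≗ (suc k)))
                          (interchange (q (suc k)) (q k) (q' (suc k)) (q' k))

divides-mulX : ∀ {f} → XPlus1Divides f → XPlus1Divides (mulX f)
divides-mulX {f} (q , q-fin , f≗) = mulX q , finSupp-mulX q-fin , product
  where
  product : ∀ k → mulX f k ≡ mulXplus1 (mulX q) k
  product zero          = refl
  product (suc zero)    = trans (f≗ zero) (sym (+-identityʳ (q zero)))
  product (suc (suc k)) = f≗ (suc k)

divides-+ₚ-mulX-self : ∀ {f} → FinSupp f → XPlus1Divides (f +ₚ mulX f)
divides-+ₚ-mulX-self {f} f-fin = f , f-fin , product
  where
  product : ∀ k → (f +ₚ mulX f) k ≡ mulXplus1 f k
  product zero    = +-identityʳ (f zero)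
  product (suc k) = refl

term : ∀ {n} → (Vec Bool n → Bool) → ℕ → Vec Bool n → ℤ
term h k s = if h s then (if wt s ≡ᵇ k then 1ℤ else 0ℤ) else 0ℤ

weightEnumOn : ∀ {n} → (Vec Bool n → Bool) → List (Vec Bool n) → Poly
weightEnumOn h ss k = foldr (λ s acc → term h k s +ℤ acc) 0ℤ ss

weightEnum : ∀ {n} → (Vec Bool n → Bool) → Poly
weightEnum {n} h = weightEnumOn h (allStrings n)

g≡weightEnum : ∀ {m} (p : Vec Bool m) n → g p n ≡ weightEnum {n} (λ s → ⌊ occurs? p s ⌋)
g≡weightEnum p n = refl

weightEnumOn-++ : ∀ {n} (h : Vec Bool n → Bool) ss ss' →
  weightEnumOn h (ss ++ ss') ≗ weightEnumOn h ss +ₚ weightEnumOn h ss'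
weightEnumOn-++ h []       ss' k = sym (+-identityˡ _)
weightEnumOn-++ h (s ∷ ss) ss' k =
  trans (cong (term h k s +ℤ_) (weightEnumOn-++ h ss ss' k))
        (sym (+-assoc (term h k s) _ _))

weightEnumOn-map-false : ∀ {n} (h : Vec Bool (suc n) → Bool) ss →
  weightEnumOn h (map (false ∷_) ss) ≗ weightEnumOn (λ s → h (false ∷ s)) ss
weightEnumOn-map-false h ss k = foldr-map _ (false ∷_) 0ℤ ss

weightEnumOn-map-true : ∀ {n} (h : Vec Bool (suc n) → Bool) ss →
  weightEnumOn h (map (true ∷_) ss) ≗ mulX (weightEnumOn (λ s → h (true ∷ s)) ss)
weightEnumOn-map-true h []       zero    = refl
weightEnumOn-map-true h (s ∷ ss) zero    =
  trans (cong (_+ℤ _) term≡0) (trans (+-identityˡ _) (weightEnumOn-map-true h ss zero))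
  where
  term≡0 : term h 0 (true ∷ s) ≡ 0ℤ
  term≡0 with h (true ∷ s)
  ... | true  = refl
  ... | false = refl
weightEnumOn-map-true h ss       (suc k) = foldr-map _ (true ∷_) 0ℤ ss

weightEnum-cong : ∀ {n} {h h' : Vec Bool n → Bool} → (∀ s → h s ≡ h' s) → weightEnum h ≗ weightEnum h'
weightEnum-cong {n} {h} {h'} h≗h' k = go (allStrings n)
  where
  go : ∀ ss → weightEnumOn h ss k ≡ weightEnumOn h' ss k
  go []       = refl
  go (s ∷ ss) =
    cong₂ _+ℤ_ (cong (λ b → if b then (if wt s ≡ᵇ k then 1ℤ else 0ℤ) else 0ℤ) (h≗h' s)) (go ss)

weightEnum-split₀ : ∀ {n} (h : Vec Bool (suc n) → Bool) →
  weightEnum h ≗ weightEnum (λ s → h (false ∷ s)) +ₚ mulX (weightEnum (λ s → h (true ∷ s)))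
weightEnum-split₀ {n} h k =
  trans (weightEnumOn-++ h (map (false ∷_) (allStrings n)) (map (true ∷_) (allStrings n)) k)
        (+ₚ-cong (weightEnumOn-map-false h (allStrings n))
                 (weightEnumOn-map-true h (allStrings n)) k)

weightEnum-splitAt : ∀ {n} (i : Fin (suc n)) (h : Vec Bool (suc n) → Bool) →
  weightEnum h ≗ weightEnum (λ s → h (insertAt s i false))
               +ₚ mulX (weightEnum (λ s → h (insertAt s i true)))
weightEnum-splitAt         zero    h = weightEnum-split₀ h
weightEnum-splitAt {suc n} (suc i) h k = begin
  weightEnum h k
    ≡⟨ weightEnum-split₀ h k ⟩
  (weightEnum h₀ +ₚ mulX (weightEnum h₁)) k
    ≡⟨ +ₚ-cong (weightEnum-splitAt i h₀) (mulX-cong (weightEnum-splitAt i h₁)) k ⟩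
  ((a +ₚ mulX b) +ₚ mulX (c +ₚ mulX d)) k
    ≡⟨ +ₚ-mulX-interchange a b c d k ⟩
  ((a +ₚ mulX c) +ₚ mulX (b +ₚ mulX d)) k
    ≡⟨ sym (+ₚ-cong (weightEnum-split₀ (λ s → h (insertAt s (suc i) false)))
                    (mulX-cong (weightEnum-split₀ (λ s → h (insertAt s (suc i) true)))) k) ⟩
  (weightEnum (λ s → h (insertAt s (suc i) false))
     +ₚ mulX (weightEnum (λ s → h (insertAt s (suc i) true)))) k ∎
  where
  open ≡-Reasoning
  h₀ h₁ : Vec Bool (suc n) → Bool
  h₀ s = h (false ∷ s)
  h₁ s = h (true ∷ s)
  a b c d : Poly
  a = weightEnum (λ s → h₀ (insertAt s i false))
  b = weightEnum (λ s → h₀ (insertAt s i true))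
  c = weightEnum (λ s → h₁ (insertAt s i false))
  d = weightEnum (λ s → h₁ (insertAt s i true))

weightEnum-finSupp : ∀ {n} (h : Vec Bool n → Bool) → FinSupp (weightEnum h)
weightEnum-finSupp {zero}  h = 1 , λ { (suc k) _ → vanish k }
  where
  vanish : ∀ k → weightEnum h (suc k) ≡ 0ℤ
  vanish k with h []
  ... | true  = refl
  ... | false = refl
weightEnum-finSupp {suc n} h =
  finSupp-resp-≗ (λ k → sym (weightEnum-split₀ h k))
    (finSupp-+ₚ (weightEnum-finSupp (λ s → h (false ∷ s)))
                 (finSupp-mulX (weightEnum-finSupp (λ s → h (true ∷ s)))))

restrict : ∀ {n} → Fin (suc n) → Bool → DTree (suc n) → DTree n
restrict i b (leaf c) = leaf c
restrict i b (query j t₀ t₁) with i ≟ j | b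
... | yes _  | false = restrict i b t₀
... | yes _  | true  = restrict i b t₁
... | no i≢j | _     = query (punchOut i≢j) (restrict i b t₀) (restrict i b t₁)

eval-query-insertAt : ∀ {n} (i : Fin (suc n)) b (t₀ t₁ : DTree (suc n)) s →
  eval (query i t₀ t₁) (insertAt s i b) ≡ eval (if b then t₁ else t₀) (insertAt s i b)
eval-query-insertAt i b t₀ t₁ s rewrite insertAt-lookup s i b with b
... | false = refl
... | true  = refl

eval-restrict : ∀ {n} (i : Fin (suc n)) b (t : DTree (suc n)) s →
  eval (restrict i b t) s ≡ eval t (insertAt s i b)
eval-restrict i b (leaf c) s = refl
eval-restrict i b (query j t₀ t₁) s with i ≟ j | b
... | yes refl | false = trans (eval-restrict i false t₀ s) (sym (eval-query-insertAt i false t₀ t₁ s))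
... | yes refl | true  = trans (eval-restrict i true t₁ s) (sym (eval-query-insertAt i true t₀ t₁ s))
... | no i≢j   | b′
  rewrite sym (insertAt-punchIn s i b′ (punchOut i≢j)) | punchIn-punchOut i≢j
  with lookup (insertAt s i b′) j
...   | false = eval-restrict i b′ t₀ s
...   | true  = eval-restrict i b′ t₁ s

depth-restrict : ∀ {n} (i : Fin (suc n)) b (t : DTree (suc n)) → depth (restrict i b t) ≤ depth t
depth-restrict i b (leaf c) = ≤-refl
depth-restrict i b (query j t₀ t₁) with i ≟ j | b
... | yes _ | false = ≤-trans (depth-restrict i false t₀) (≤-trans (m≤m⊔n _ _) (n≤1+n _))
... | yes _ | true  = ≤-trans (depth-restrict i true t₁) (≤-trans (m≤n⊔m _ _) (n≤1+n _))
... | no _  | b′    = s≤s (⊔-mono-≤ (depth-restrict i b′ t₀) (depth-restrict i b′ t₁))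

depth-branch : ∀ {n} b (t₀ t₁ : DTree n) → depth (if b then t₁ else t₀) ≤ depth t₀ ⊔ depth t₁
depth-branch false t₀ t₁ = m≤m⊔n (depth t₀) (depth t₁)
depth-branch true  t₀ t₁ = m≤n⊔m (depth t₀) (depth t₁)

shallowTree-divides : ∀ {n} (t : DTree n) → depth t < n → XPlus1Divides (weightEnum (eval t))
shallowTree-divides {suc n} (leaf c) _ =
  divides-resp-≗ (λ k → sym (weightEnum-split₀ {n} (λ _ → c) k))
    (divides-+ₚ-mulX-self (weightEnum-finSupp {n} (λ _ → c)))
shallowTree-divides {suc n} t@(query i t₀ t₁) (s≤s depth<n) =
  divides-resp-≗ (λ k → sym (weightEnum-splitAt i (eval t) k))
    (divides-+ₚ (restriction-divides false) (divides-mulX (restriction-divides true)))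
  where
  restriction-divides : ∀ b → XPlus1Divides (weightEnum (λ s → eval t (insertAt s i b)))
  restriction-divides b =
    divides-resp-≗
      (weightEnum-cong λ s → trans (eval-restrict i b tᵇ s) (sym (eval-query-insertAt i b t₀ t₁ s)))
      (shallowTree-divides (restrict i b tᵇ)
        (≤-<-trans (≤-trans (depth-restrict i b tᵇ) (depth-branch b t₀ t₁)) depth<n))
    where
    tᵇ = if b then t₁ else t₀

liftTree : ∀ {n} → DTree n → DTree (suc n)
liftTree (leaf b)        = leaf b
liftTree (query i t₀ t₁) = query (suc i) (liftTree t₀) (liftTree t₁)

eval-liftTree : ∀ {n} (t : DTree n) c s → eval (liftTree t) (c ∷ s) ≡ eval t s
eval-liftTree (leaf b)        c s = refl
eval-liftTree (query i t₀ t₁) c s with lookup s i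
... | false = eval-liftTree t₀ c s
... | true  = eval-liftTree t₁ c s

depth-liftTree : ∀ {n} (t : DTree n) → depth (liftTree t) ≡ depth t
depth-liftTree (leaf b)        = refl
depth-liftTree (query i t₀ t₁) = cong₂ (λ d₀ d₁ → suc (d₀ ⊔ d₁)) (depth-liftTree t₀) (depth-liftTree t₁)

completeTree : ∀ n → (Vec Bool n → Bool) → DTree n
completeTree zero    h = leaf (h [])
completeTree (suc n) h =
  query zero (liftTree (completeTree n (λ s → h (false ∷ s))))
             (liftTree (completeTree n (λ s → h (true ∷ s))))

eval-completeTree : ∀ n h (s : Vec Bool n) → eval (completeTree n h) s ≡ h s
eval-completeTree zero    h []      = refl
eval-completeTree (suc n) h (b ∷ s) with b
... | false = trans (eval-liftTree (completeTree n _) false s) (eval-completeTree n (λ s → h (false ∷ s)) s)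
... | true  = trans (eval-liftTree (completeTree n _) true s) (eval-completeTree n (λ s → h (true ∷ s)) s)

depth-completeTree : ∀ n h → depth (completeTree n h) ≡ n
depth-completeTree zero    h = refl
depth-completeTree (suc n) h = begin
  suc (depth (liftTree t₀) ⊔ depth (liftTree t₁))
    ≡⟨ cong₂ (λ d₀ d₁ → suc (d₀ ⊔ d₁)) (depth-liftTree t₀) (depth-liftTree t₁) ⟩
  suc (depth t₀ ⊔ depth t₁)
    ≡⟨ cong₂ (λ d₀ d₁ → suc (d₀ ⊔ d₁)) (depth-completeTree n _) (depth-completeTree n _) ⟩
  suc (n ⊔ n)
    ≡⟨ cong suc (⊔-idem n) ⟩
  suc n ∎
  where
  open ≡-Reasoning
  t₀ t₁ : DTree n
  t₀ = completeTree n (λ s → h (false ∷ s))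
  t₁ = completeTree n (λ s → h (true ∷ s))

nondivisible⇒evasiveAt : ∀ {m} (p : Vec Bool m) n → ¬ XPlus1Divides (g p n) → DIs p n n
nondivisible⇒evasiveAt p n ¬x+1∣g =
  (completeTree n occurs , eval-completeTree n occurs , depth-completeTree n occurs) , n≤depth
  where
  occurs : Vec Bool n → Bool
  occurs s = ⌊ occurs? p s ⌋
  n≤depth : ∀ t → Decides p t → n ≤ depth t
  n≤depth t t-decides with depth t <? n
  ... | no  depth≮n = ≮⇒≥ depth≮n
  ... | yes depth<n = contradiction
    (subst XPlus1Divides (sym (g≡weightEnum p n))
      (divides-resp-≗ (weightEnum-cong t-decides) (shallowTree-divides t depth<n)))
    ¬x+1∣g

corollary1 : ∀ {m} (p : Vec Bool m) (N₀ : ℕ)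
    → (∀ n → N₀ < n → ¬ XPlus1Divides (g p n))
    → (∀ n → N₀ < n → DIs p n n) × Evasive p
corollary1 p N₀ nondivisible = evasiveAt , (N₀ , evasiveAt)
  where
  evasiveAt : ∀ n → N₀ < n → DIs p n n
  evasiveAt n N₀<n = nondivisible⇒evasiveAt p n (nondivisible n N₀<n)
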